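{- Let $C$ be a $c$-colored directed cycle of odd length, $w\in V(C)$, and let $G$ be obtained from $C$ by adding a new vertex $v$ (with a color $c(v)$) and the arc $(w,v)$. Then $G$ has an up-color kernel if and only if $c(v)>c(w)$ and $C\setminus\{w\}=G\setminus\{v,w\}$ has an up-color kernel.
   Context: A $c$-coloring is a function $c:V\to\{0,1,2,\ldots\}$. A set $N$ of vertices is up-color absorbent if every vertex $x\notin N$ has an out-neighbor $y\in N$ with $c(x)<c(y)$, and no vertex of $N$ has color $0$. An up-color kernel is an independent up-color absorbent set. -}

module Defs where

open import Data.Nat using (ℕ; zero; suc; _<_; NonZero)
open import Data.Nat.DivMod using (_%_)
open import Data.Fin using (Fin; toℕ)
open import Data.Bool using (Bool; true; false)
open import Data.Product using (Σ; ∃-syntax; _×_)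
open import Data.Sum using (_⊎_; inj₁; inj₂)
open import Data.Unit using (⊤; tt)
open import Data.Empty using (⊥)
open import Relation.Nullary using (¬_)
open import Relation.Binary.PropositionalEquality using (_≡_; _≢_)

record Digraph : Set₁ where
  field
    V   : Set
    Arc : V → V → Set
open Digraph public

Coloring : Digraph → Set
Coloring D = V D → ℕ

VSet : Digraph → Set
VSet D = V D → Bool

_∈ᵥ_ : {D : Digraph} → V D → VSet D → Set
x ∈ᵥ N = N x ≡ true

_∉ᵥ_ : {D : Digraph} → V D → VSet D → Set
x ∉ᵥ N = N x ≡ false

Independent : (D : Digraph) → VSet D → Set
Independent D N = ∀ x y → _∈ᵥ_ {D} x N → _∈ᵥ_ {D} y N → ¬ Arc D x y

UpColorAbsorbent : (D : Digraph) → Coloring D → VSet D → Set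
UpColorAbsorbent D c N =
  (∀ x → _∉ᵥ_ {D} x N → ∃[ y ] (Arc D x y × _∈ᵥ_ {D} y N × c x < c y))
  × (∀ x → _∈ᵥ_ {D} x N → c x ≢ 0)

IsUpColorKernel : (D : Digraph) → Coloring D → VSet D → Set
IsUpColorKernel D c N = Independent D N × UpColorAbsorbent D c N

HasUpColorKernel : (D : Digraph) → Coloring D → Set
HasUpColorKernel D c = ∃[ N ] IsUpColorKernel D c N

Cycle : (n : ℕ) → .{{_ : NonZero n}} → Digraph
Cycle n = record { V = Fin n ; Arc = λ i j → toℕ j ≡ suc (toℕ i) % n }

DeleteVertex : (D : Digraph) → V D → Digraph
DeleteVertex D w = record
  { V = Σ (V D) (λ x → x ≢ w)
  ; Arc = λ x y → Arc D (Data.Product.proj₁ x) (Data.Product.proj₁ y) }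

restrictColoring : (D : Digraph) (w : V D) → Coloring D → Coloring (DeleteVertex D w)
restrictColoring D w c x = c (Data.Product.proj₁ x)

-- D plus a new vertex v (represented by inj₂ tt) and the single arc (w , v).
AddPendant : (D : Digraph) → V D → Digraph
AddPendant D w = record { V = V D ⊎ ⊤ ; Arc = arc }
  where
  arc : V D ⊎ ⊤ → V D ⊎ ⊤ → Set
  arc (inj₁ x) (inj₁ y) = Arc D x y
  arc (inj₁ x) (inj₂ _) = x ≡ w
  arc (inj₂ _) _        = ⊥

extendColoring : (D : Digraph) (w : V D) → Coloring D → ℕ → Coloring (AddPendant D w)
extendColoring D w c cv (inj₁ x) = c x
extendColoring D w c cv (inj₂ _) = cv

-- A kernel of G must contain the sink v, hence avoids w, and so restricts to a
-- kernel of C − w. If moreover c(v) ≤ c(w), then w is not absorbed through v and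
-- the restriction is even a kernel of C; but a kernel of a directed cycle
-- alternates along the arcs, which is impossible on an odd cycle. Conversely,
-- when c(w) < c(v), adding v to a kernel of C − w gives a kernel of G.
module Submission where

open import Defs
open import Data.Nat using (ℕ; suc; _+_; _*_; _<_; _≤_; NonZero)
open import Data.Nat.DivMod using (_%_; _/_; _mod_; m%n<n; m≡m%n+[m/n]*n; [m+n]%n≡m%n; [m+kn]%n≡m%n)
open import Data.Nat.Properties using (_<?_; n≮0)
open import Data.Fin using (Fin; toℕ)
open import Data.Fin.Properties using (toℕ-injective; toℕ-fromℕ<; fromℕ<-cong; _≟_)
open import Data.Bool using (Bool; true; false; not)
open import Data.Bool.Properties using (not-involutive; not-¬; ¬-not)
open import Data.Product using (_×_; _,_; ∃-syntax; proj₁)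
open import Data.Sum using (inj₁; inj₂)
open import Data.Unit using (tt)
open import Data.Empty using (⊥-elim)
open import Function.Bundles using (_⇔_; mk⇔)
open import Relation.Nullary using (¬_; yes; no)
open import Relation.Nullary.Decidable using (decidable-stable)
open import Relation.Binary.Definitions using (DecidableEquality)
open import Relation.Binary.PropositionalEquality
  using (_≡_; _≢_; refl; sym; trans; cong; subst; module ≡-Reasoning)

module _ (n : ℕ) .{{_ : NonZero n}} where

  next : Fin n → Fin n
  next i = suc (toℕ i) mod n

  cycle-arc-next : ∀ i → Arc (Cycle n) i (next i)
  cycle-arc-next i = toℕ-fromℕ< (m%n<n (suc (toℕ i)) n)

  cycle-arc⇒next : ∀ {i j} → Arc (Cycle n) i j → j ≡ next i
  cycle-arc⇒next {i} arc = toℕ-injective (trans arc (sym (cycle-arc-next i)))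

  mod-cong : ∀ {k m} → k % n ≡ m % n → k mod n ≡ m mod n
  mod-cong {k} {m} eq = fromℕ<-cong _ _ eq (m%n<n k n) (m%n<n m n)

  next-mod : ∀ k → next (k mod n) ≡ suc k mod n
  next-mod k = mod-cong (begin
    suc (toℕ (k mod n)) % n         ≡⟨ cong (λ r → suc r % n) (toℕ-fromℕ< (m%n<n k n)) ⟩
    suc (k % n) % n                 ≡⟨ sym ([m+kn]%n≡m%n (suc (k % n)) (k / n) n) ⟩
    (suc (k % n) + k / n * n) % n   ≡⟨ cong (λ r → suc r % n) (sym (m≡m%n+[m/n]*n k n)) ⟩
    suc k % n                       ∎)
    where open ≡-Reasoning

  odd-cycle-¬alternating : n % 2 ≡ 1 → (f : Fin n → Bool) → ¬ (∀ i → f (next i) ≡ not (f i))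
  odd-cycle-¬alternating odd f alt = not-¬ refl (begin
    f (0 mod n)                 ≡⟨ cong f (mod-cong ([m+n]%n≡m%n 0 n)) ⟨
    f (n mod n)                 ≡⟨ cong (λ m → f (m mod n)) n≡1+[n/2]*2 ⟩
    f (suc (n / 2 * 2) mod n)   ≡⟨ alt-mod (n / 2 * 2) ⟩
    not (f (n / 2 * 2 mod n))   ≡⟨ cong not (even-mod (n / 2)) ⟩
    not (f (0 mod n))           ∎)
    where
    open ≡-Reasoning
    n≡1+[n/2]*2 : n ≡ suc (n / 2 * 2)
    n≡1+[n/2]*2 = trans (m≡m%n+[m/n]*n n 2) (cong (λ r → r + n / 2 * 2) odd)
    alt-mod : ∀ k → f (suc k mod n) ≡ not (f (k mod n))
    alt-mod k = trans (cong f (sym (next-mod k))) (alt (k mod n))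
    even-mod : ∀ q → f (q * 2 mod n) ≡ f (0 mod n)
    even-mod 0       = refl
    even-mod (suc q) = begin
      f (suc (suc (q * 2)) mod n)   ≡⟨ alt-mod (suc (q * 2)) ⟩
      not (f (suc (q * 2) mod n))   ≡⟨ cong not (alt-mod (q * 2)) ⟩
      not (not (f (q * 2 mod n)))   ≡⟨ not-involutive _ ⟩
      f (q * 2 mod n)               ≡⟨ even-mod q ⟩
      f (0 mod n)                   ∎

  cycle-kernel-alternates : ∀ {c N} → IsUpColorKernel (Cycle n) c N → ∀ i → N (next i) ≡ not (N i)
  cycle-kernel-alternates {N = N} (ind , absorb , _) i with N i in i∈N
  ... | true  = ¬-not (λ next∈N → ind i (next i) i∈N next∈N (cycle-arc-next i))
  ... | false with absorb i i∈N
  ...   | j , arc , j∈N , _ = subst (λ k → N k ≡ true) (cycle-arc⇒next arc) j∈N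

  odd-cycle-¬kernel : n % 2 ≡ 1 → (c : Coloring (Cycle n)) → ¬ HasUpColorKernel (Cycle n) c
  odd-cycle-¬kernel odd c (N , isKernel) = odd-cycle-¬alternating odd N (cycle-kernel-alternates isKernel)

module _ (D : Digraph) (w : V D) (c : Coloring D) (cv : ℕ) {N : VSet (AddPendant D w)} where

  pendant∈kernel : IsUpColorKernel (AddPendant D w) (extendColoring D w c cv) N → N (inj₂ tt) ≡ true
  pendant∈kernel (_ , absorb , _) with N (inj₂ tt) in v∉N
  ... | true  = refl
  ... | false with absorb (inj₂ tt) v∉N
  ...   | _ , () , _

  attachment∉kernel :
    IsUpColorKernel (AddPendant D w) (extendColoring D w c cv) N → N (inj₁ w) ≡ false
  attachment∉kernel isKernel@(ind , _) =
    ¬-not (λ w∈N → ind (inj₁ w) (inj₂ tt) w∈N (pendant∈kernel isKernel) refl)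

  kernel-restricts-to-deleteVertex : IsUpColorKernel (AddPendant D w) (extendColoring D w c cv) N →
    IsUpColorKernel (DeleteVertex D w) (restrictColoring D w c) (λ x → N (inj₁ (proj₁ x)))
  kernel-restricts-to-deleteVertex isKernel@(ind , absorb , nonzero) =
    (λ x y → ind (inj₁ (proj₁ x)) (inj₁ (proj₁ y))) , absorbed , λ x → nonzero (inj₁ (proj₁ x))
    where
    absorbed : ∀ x → N (inj₁ (proj₁ x)) ≡ false →
      ∃[ y ] (Arc D (proj₁ x) (proj₁ y) × N (inj₁ (proj₁ y)) ≡ true × c (proj₁ x) < c (proj₁ y))
    absorbed (x , x≢w) x∉N with absorb (inj₁ x) x∉N
    ... | inj₂ tt , x≡w , _         = ⊥-elim (x≢w x≡w)
    ... | inj₁ y  , arc , y∈N , c< = (y , y≢w) , arc , y∈N , c<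
      where
      y≢w : y ≢ w
      y≢w refl = not-¬ (attachment∉kernel isKernel) y∈N

  kernel-restricts-to-base : IsUpColorKernel (AddPendant D w) (extendColoring D w c cv) N →
    ¬ c w < cv → IsUpColorKernel D c (λ x → N (inj₁ x))
  kernel-restricts-to-base (ind , absorb , nonzero) w≮v =
    (λ x y → ind (inj₁ x) (inj₁ y)) , absorbed , λ x → nonzero (inj₁ x)
    where
    absorbed : ∀ x → N (inj₁ x) ≡ false → ∃[ y ] (Arc D x y × N (inj₁ y) ≡ true × c x < c y)
    absorbed x x∉N with absorb (inj₁ x) x∉N
    ... | inj₂ tt , refl , _ , c< = ⊥-elim (w≮v c<)
    ... | inj₁ y  , arc  , y∈N , c< = y , arc , y∈N , c<

-- x ≢ w is a function type, so without function extensionality (x , p) and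
-- (x , q) are different vertices; the kernel axioms force them to agree.
deleteVertex-kernel-irrelevant : ∀ D w {c K} → IsUpColorKernel (DeleteVertex D w) c K →
  ∀ {x p q} → K (x , p) ≡ true → K (x , q) ≡ true
deleteVertex-kernel-irrelevant D w {K = K} (ind , absorb , _) {x} {p} {q} xp∈K
  with K (x , q) in xq∉K
... | true  = refl
... | false with absorb (x , q) xq∉K
...   | y , arc , y∈K , _ = ⊥-elim (ind (x , p) y xp∈K y∈K arc)

module _ (D : Digraph) (_≟ᵥ_ : DecidableEquality (V D)) (w : V D) where

  extendKernel : VSet (DeleteVertex D w) → VSet (AddPendant D w)
  extendKernel K (inj₂ _) = true
  extendKernel K (inj₁ x) with x ≟ᵥ w
  ... | yes _   = false
  ... | no x≢w = K (x , x≢w)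

  extendKernel-∈⁻ : ∀ {K x} → extendKernel K (inj₁ x) ≡ true → ∃[ x≢w ] K (x , x≢w) ≡ true
  extendKernel-∈⁻ {x = x} x∈N with x ≟ᵥ w
  ... | no x≢w = x≢w , x∈N

  extendKernel-∈⁺ : ∀ {c K} → IsUpColorKernel (DeleteVertex D w) c K →
    ∀ {x x≢w} → K (x , x≢w) ≡ true → extendKernel K (inj₁ x) ≡ true
  extendKernel-∈⁺ isKernel {x} {x≢w} x∈K with x ≟ᵥ w
  ... | yes x≡w = ⊥-elim (x≢w x≡w)
  ... | no _ = deleteVertex-kernel-irrelevant D w isKernel x∈K

  extendKernel-isKernel : ∀ {c cv K} → c w < cv →
    IsUpColorKernel (DeleteVertex D w) (restrictColoring D w c) K →
    IsUpColorKernel (AddPendant D w) (extendColoring D w c cv) (extendKernel K)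
  extendKernel-isKernel {c} {cv} {K} w<v isKernel@(ind , absorb , nonzero) =
    independent , absorbed , nonzero′
    where
    independent : Independent (AddPendant D w) (extendKernel K)
    independent (inj₁ x) (inj₁ y) x∈N y∈N arc with extendKernel-∈⁻ x∈N | extendKernel-∈⁻ y∈N
    ... | x≢w , x∈K | y≢w , y∈K = ind (x , x≢w) (y , y≢w) x∈K y∈K arc
    independent (inj₁ x) (inj₂ _) x∈N _ x≡w = proj₁ (extendKernel-∈⁻ x∈N) x≡w
    absorbed : ∀ x → extendKernel K x ≡ false →
      ∃[ y ] (Arc (AddPendant D w) x y × extendKernel K y ≡ true
              × extendColoring D w c cv x < extendColoring D w c cv y)
    absorbed (inj₁ x) x∉N with x ≟ᵥ w
    ... | yes refl = inj₂ tt , refl , refl , w<v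
    ... | no x≢w with absorb (x , x≢w) x∉N
    ...   | (y , y≢w) , arc , y∈K , c< = inj₁ y , arc , extendKernel-∈⁺ isKernel y∈K , c<
    nonzero′ : ∀ x → extendKernel K x ≡ true → extendColoring D w c cv x ≢ 0
    nonzero′ (inj₁ x) x∈N with extendKernel-∈⁻ x∈N
    ... | x≢w , x∈K = nonzero (x , x≢w) x∈K
    nonzero′ (inj₂ _) _ cv≡0 = n≮0 (subst (c w <_) cv≡0 w<v)

mainTheorem11 : (n : ℕ) → .{{_ : NonZero n}} → 3 ≤ n → n % 2 ≡ 1 →
    (c : Fin n → ℕ) (w : Fin n) (cv : ℕ) →
    HasUpColorKernel (AddPendant (Cycle n) w) (extendColoring (Cycle n) w c cv)
      ⇔ (c w < cv × HasUpColorKernel (DeleteVertex (Cycle n) w) (restrictColoring (Cycle n) w c))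
mainTheorem11 n _ odd c w cv = mk⇔ forward backward
  where
  forward : HasUpColorKernel (AddPendant (Cycle n) w) (extendColoring (Cycle n) w c cv) →
    c w < cv × HasUpColorKernel (DeleteVertex (Cycle n) w) (restrictColoring (Cycle n) w c)
  forward (_ , isKernel) =
      decidable-stable (c w <? cv) (λ w≮v →
        odd-cycle-¬kernel n odd c (_ , kernel-restricts-to-base (Cycle n) w c cv isKernel w≮v))
    , (_ , kernel-restricts-to-deleteVertex (Cycle n) w c cv isKernel)
  backward : c w < cv × HasUpColorKernel (DeleteVertex (Cycle n) w) (restrictColoring (Cycle n) w c) →
    HasUpColorKernel (AddPendant (Cycle n) w) (extendColoring (Cycle n) w c cv)
  backward (w<v , _ , isKernel) = _ , extendKernel-isKernel (Cycle n) _≟_ w w<v isKernel
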